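{- Let $D$ be a finite digraph. Then the Ferrers dimension of $D$ equals the total covering number of $J(\overline{D})$.
   Context: Digraphs may have loops and are identified with their $(0,1)$ adjacency matrices; $\overline{D}$ is the digraph on the same vertex set whose adjacency matrix is obtained from that of $D$ by interchanging $0$'s and $1$'s (including diagonal entries). A Ferrers digraph is a digraph whose successor sets $\{u: vu\text{ is an arc}\}$ are linearly ordered by inclusion (equivalently, its adjacency matrix contains no $2\times2$ permutation submatrix). The Ferrers dimension $d_F(D)$ is the minimum number of Ferrers digraphs on $V(D)$ whose intersection (of arc sets) is $D$ (the empty intersection being the complete digraph with all loops). For a digraph $D'=(V,E)$, $J(D')$ is the digraph with vertex set $E$ and an arc from $ab\in E$ to $cd\in E$ iff $ab\neq cd$ and $ad\in E$ (the vertices $a,b,c,d$ need not be distinct). A subdigraph $S$ of $J(D')$ is ideal if whenever $ab\to cd$ is an arc of $S$, then $ad\in V(S)$. An ideal subdigraph $S$ is total if for any distinct $ab,cd\in V(S)$, at least one of $ab\to cd$, $cd\to ab$ is an arc of $S$. The total covering number of $J(D')$ is the minimum number of total subdigraphs of $J(D')$ whose vertex sets together cover $E$. -}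

module Defs where

open import Data.Nat using (ℕ; _≤_)
open import Data.Fin using (Fin)
open import Data.Bool using (Bool; true; false; not)
open import Data.Product using (Σ; _×_; ∃-syntax)
open import Data.Sum using (_⊎_)
open import Relation.Nullary using (¬_)
open import Relation.Binary.PropositionalEquality using (_≡_)
open import Function.Bundles using (_⇔_)

-- A digraph (loops allowed) on vertex set Fin n, identified with its
-- (0,1) adjacency matrix: D a b ≡ true iff ab is an arc.
Digraph : ℕ → Set
Digraph n = Fin n → Fin n → Bool

-- Complement: interchange 0's and 1's (including the diagonal).
complement : ∀ {n} → Digraph n → Digraph n
complement D a b = not (D a b)

IsFerrers : ∀ {n} → Digraph n → Set
IsFerrers {n} F = ∀ (v w : Fin n) →
  (∀ u → F v u ≡ true → F w u ≡ true) ⊎ (∀ u → F w u ≡ true → F v u ≡ true)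

-- D is the intersection (of arc sets) of k Ferrers digraphs on V(D).
-- (For k = 0 the empty intersection is the complete digraph with all loops.)
FerrersRep : ∀ {n} → Digraph n → ℕ → Set
FerrersRep {n} D k = Σ (Fin k → Digraph n) λ F →
  (∀ i → IsFerrers (F i)) ×
  (∀ a b → (D a b ≡ true) ⇔ (∀ i → F i a b ≡ true))

JArc : ∀ {n} → Digraph n → Fin n → Fin n → Fin n → Fin n → Set
JArc D' a b c d =
  (D' a b ≡ true) × (D' c d ≡ true) × ¬ (a ≡ c × b ≡ d) × (D' a d ≡ true)

record SubJ {n} (D' : Digraph n) : Set where
  field
    vert : Fin n → Fin n → Bool
    arc  : Fin n → Fin n → Fin n → Fin n → Bool
    vert⊆E  : ∀ a b → vert a b ≡ true → D' a b ≡ true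
    arc-src : ∀ a b c d → arc a b c d ≡ true → vert a b ≡ true
    arc-tgt : ∀ a b c d → arc a b c d ≡ true → vert c d ≡ true
    arc⊆J   : ∀ a b c d → arc a b c d ≡ true → JArc D' a b c d
open SubJ public

IsIdeal : ∀ {n} {D' : Digraph n} → SubJ D' → Set
IsIdeal {n} S = ∀ (a b c d : Fin n) → arc S a b c d ≡ true → vert S a d ≡ true

IsTotal : ∀ {n} {D' : Digraph n} → SubJ D' → Set
IsTotal {n} S = IsIdeal S ×
  (∀ (a b c d : Fin n) → vert S a b ≡ true → vert S c d ≡ true →
     ¬ (a ≡ c × b ≡ d) → (arc S a b c d ≡ true) ⊎ (arc S c d a b ≡ true))

TotalCover : ∀ {n} → Digraph n → ℕ → Set
TotalCover {n} D' k = Σ (Fin k → SubJ D') λ S →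
  (∀ i → IsTotal (S i)) ×
  (∀ a b → D' a b ≡ true → ∃[ i ] (vert (S i) a b ≡ true))

IsMinimum : (ℕ → Set) → ℕ → Set
IsMinimum P m = P m × (∀ k → P k → m ≤ k)

FerrersDim : ∀ {n} → Digraph n → ℕ → Set
FerrersDim D = IsMinimum (FerrersRep D)

TotalCoveringNumber : ∀ {n} → Digraph n → ℕ → Set
TotalCoveringNumber D' = IsMinimum (TotalCover D')

module Submission where

-- The whole proof rests on one correspondence, valid for every digraph D':
-- the vertex set of a total subdigraph of J(D') is the complement of a
-- Ferrers digraph (total⇒ferrers), and conversely the complement of any
-- Ferrers digraph F with F̄ ⊆ E(D') is the vertex set of a total
-- subdigraph of J(D') (ferrersSub, ferrersSub-total).  Taking D' = D̄,
-- "D is the intersection of F₁,…,F_k" becomes "the sets F̄ᵢ cover E(D̄)",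
-- so a Ferrers representation of D with k digraphs exists iff a total
-- cover of J(D̄) with k subdigraphs does (ferrers⇒cover, cover⇒ferrers).
--
-- It remains to see that a least k exists.  Representations with k
-- digraphs are finite objects, so their existence is decidable (finite
-- function spaces are exhaustible), and D is the intersection of its n
-- "row" digraphs, each Ferrers; the least number principle for decidable
-- predicates then yields the Ferrers dimension, which by the
-- correspondence is also the total covering number.

open import Defs
open import Data.Nat using (ℕ; zero; suc; _≤_; _<_; _≤?_)
open import Data.Nat.Properties using (≰⇒>; ≤-refl; m≤n⇒m<n∨m≡n; ≤-pred)
open import Data.Product using (∃; ∃-syntax; _×_; _,_; proj₁; proj₂)
open import Data.Sum using (_⊎_; inj₁; inj₂; [_,_])
open import Data.Bool using (Bool; true; false; not)
open import Data.Bool.Properties using (_≟_)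
open import Data.Fin using (Fin) renaming (zero to fzero; suc to fsuc)
open import Data.Fin.Properties using (all?; ¬∀⟶∃¬) renaming (_≟_ to _≟ᶠ_)
open import Data.Vec.Functional using (Vector; []; _∷_; head; tail)
open import Data.Vec.Functional.Relation.Binary.Pointwise using (Pointwise)
open import Data.Empty using (⊥-elim)
open import Relation.Nullary using (¬_; Dec; yes; no; does)
open import Relation.Nullary.Decidable
  using (map′; _×-dec_; _⊎-dec_; _→-dec_; ¬?; dec-true; decidable-stable)
open import Level using (0ℓ)
open import Relation.Binary.Core using (Rel)
open import Relation.Binary.Definitions using (Reflexive)
open import Relation.Binary.PropositionalEquality using (_≡_; refl; sym; subst)
open import Function using (_∘′_)
open import Function.Bundles using (_⇔_; mk⇔; Equivalence)

not-true⇒¬ : ∀ {x} → not x ≡ true → ¬ (x ≡ true)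
not-true⇒¬ {false} _ ()

¬⇒not-true : ∀ {x} → ¬ (x ≡ true) → not x ≡ true
¬⇒not-true {false} _  = refl
¬⇒not-true {true}  ¬t = ⊥-elim (¬t refl)

does-true⇒ : ∀ {Q : Set} (q? : Dec Q) → does q? ≡ true → Q
does-true⇒ (yes q) _ = q

_⇔-dec_ : ∀ {A B : Set} → Dec A → Dec B → Dec (A ⇔ B)
A? ⇔-dec B? = map′ (λ (f , g) → mk⇔ f g) (λ e → Equivalence.to e , Equivalence.from e)
                   ((A? →-dec B?) ×-dec (B? →-dec A?))

module _ {n : ℕ} {D' : Digraph n} where

  NonArcJ : Digraph n → Fin n → Fin n → Fin n → Fin n → Set
  NonArcJ F a b c d = not (F a b) ≡ true × not (F c d) ≡ true ×
                      ¬ (a ≡ c × b ≡ d) × not (F a d) ≡ true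

  nonArcJ? : ∀ F a b c d → Dec (NonArcJ F a b c d)
  nonArcJ? F a b c d = (not (F a b) ≟ true) ×-dec (not (F c d) ≟ true) ×-dec
                       ¬? ((a ≟ᶠ c) ×-dec (b ≟ᶠ d)) ×-dec (not (F a d) ≟ true)

  ferrersSub : (F : Digraph n) → (∀ a b → not (F a b) ≡ true → D' a b ≡ true) → SubJ D'
  ferrersSub F F̄⊆E = record
    { vert    = complement F
    ; arc     = λ a b c d → does (nonArcJ? F a b c d)
    ; vert⊆E  = F̄⊆E
    ; arc-src = λ a b c d h → proj₁ (spec a b c d h)
    ; arc-tgt = λ a b c d h → proj₁ (proj₂ (spec a b c d h))
    ; arc⊆J   = λ a b c d h →
        let (ab , cd , ab≢cd , ad) = spec a b c d h
        in F̄⊆E a b ab , F̄⊆E c d cd , ab≢cd , F̄⊆E a d ad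
    }
    where
    spec : ∀ a b c d → does (nonArcJ? F a b c d) ≡ true → NonArcJ F a b c d
    spec a b c d = does-true⇒ (nonArcJ? F a b c d)

  -- If F is Ferrers, this subdigraph is total: for distinct non-arcs ab, cd
  -- of F, comparing the successor sets of a and c shows that ad or cb is
  -- a non-arc of F, giving the arc ab → cd or cd → ab.
  ferrersSub-total : ∀ F (F̄⊆E : ∀ a b → not (F a b) ≡ true → D' a b ≡ true) →
                     IsFerrers F → IsTotal (ferrersSub F F̄⊆E)
  ferrersSub-total F _ ferrers = ideal , total
    where
    ideal : ∀ a b c d → does (nonArcJ? F a b c d) ≡ true → not (F a d) ≡ true
    ideal a b c d h = proj₂ (proj₂ (proj₂ (does-true⇒ (nonArcJ? F a b c d) h)))

    total : ∀ a b c d → not (F a b) ≡ true → not (F c d) ≡ true → ¬ (a ≡ c × b ≡ d) →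
            (does (nonArcJ? F a b c d) ≡ true) ⊎ (does (nonArcJ? F c d a b) ≡ true)
    total a b c d ab cd ab≢cd with ferrers a c
    ... | inj₁ Fa⊆Fc = inj₁ (dec-true (nonArcJ? F a b c d)
                              (ab , cd , ab≢cd , ¬⇒not-true (not-true⇒¬ cd ∘′ Fa⊆Fc d)))
    ... | inj₂ Fc⊆Fa = inj₂ (dec-true (nonArcJ? F c d a b)
                              (cd , ab , (λ (c≡a , d≡b) → ab≢cd (sym c≡a , sym d≡b)) ,
                               ¬⇒not-true (not-true⇒¬ ab ∘′ Fc⊆Fa b)))

  -- If some wd ∈ V(S) has vd ∉ V(S), then every vb ∈ V(S)
  -- must be compared with wd; the arc vb → wd would put vd into the ideal
  -- S, so wd → vb is an arc and wb ∈ V(S).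
  total⇒ferrers : (S : SubJ D') → IsTotal S → IsFerrers (complement (vert S))
  total⇒ferrers S (ideal , total) v w
    with all? (λ u → (vert S w u ≟ true) →-dec (vert S v u ≟ true))
  ... | yes Vw⊆Vv = inj₁ λ u h → ¬⇒not-true (λ wu → not-true⇒¬ h (Vw⊆Vv u wu))
  ... | no Vw⊈Vv = inj₂ λ b h → ¬⇒not-true (λ vb → not-true⇒¬ h (reach b vb))
    where
    witness : ∃ λ d → ¬ (vert S w d ≡ true → vert S v d ≡ true)
    witness = ¬∀⟶∃¬ n _ (λ u → (vert S w u ≟ true) →-dec (vert S v u ≟ true)) Vw⊈Vv

    d = proj₁ witness

    wd : vert S w d ≡ true
    wd = decidable-stable (vert S w d ≟ true) (λ ¬wd → proj₂ witness (λ wd → ⊥-elim (¬wd wd)))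

    ¬vd : ¬ (vert S v d ≡ true)
    ¬vd vd = proj₂ witness (λ _ → vd)

    reach : ∀ b → vert S v b ≡ true → vert S w b ≡ true
    reach b vb with total v b w d vb wd (λ { (refl , refl) → ¬vd vb })
    ... | inj₁ vb→wd = ⊥-elim (¬vd (ideal v b w d vb→wd))
    ... | inj₂ wd→vb = ideal w d v b wd→vb

module _ {n : ℕ} {D : Digraph n} {k : ℕ} where

  -- Each Fᵢ ⊇ D gives the total subdigraph on F̄ᵢ ⊆ E(D̄), and a non-arc
  -- of D is a non-arc of some Fᵢ, so these subdigraphs cover E(D̄).
  ferrers⇒cover : FerrersRep D k → TotalCover (complement D) k
  ferrers⇒cover (F , ferrers , D≡⋂F) = S , (λ i → ferrersSub-total (F i) (F̄⊆D̄ i) (ferrers i)) , cover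
    where
    F̄⊆D̄ : ∀ i a b → not (F i a b) ≡ true → not (D a b) ≡ true
    F̄⊆D̄ i a b h = ¬⇒not-true (λ ab → not-true⇒¬ h (Equivalence.to (D≡⋂F a b) ab i))

    S : Fin k → SubJ (complement D)
    S i = ferrersSub (F i) (F̄⊆D̄ i)

    cover : ∀ a b → not (D a b) ≡ true → ∃[ i ] (not (F i a b) ≡ true)
    cover a b h =
      let (i , ¬Fiab) = ¬∀⟶∃¬ k _ (λ i → F i a b ≟ true)
                          (λ inAll → not-true⇒¬ h (Equivalence.from (D≡⋂F a b) inAll))
      in i , ¬⇒not-true ¬Fiab

  -- The complements of the vertex sets of a total cover are Ferrers
  -- digraphs containing D, and they intersect exactly in D because the
  -- vertex sets cover E(D̄).
  cover⇒ferrers : TotalCover (complement D) k → FerrersRep D k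
  cover⇒ferrers (S , total , cover) = F , (λ i → total⇒ferrers (S i) (total i)) , D≡⋂F
    where
    F : Fin k → Digraph n
    F i = complement (vert (S i))

    D≡⋂F : ∀ a b → (D a b ≡ true) ⇔ (∀ i → F i a b ≡ true)
    D≡⋂F a b = mk⇔
      (λ ab i → ¬⇒not-true (λ v → not-true⇒¬ (vert⊆E (S i) a b v) ab))
      (λ inAll → decidable-stable (D a b ≟ true) λ ¬ab →
         let (i , v) = cover a b (¬⇒not-true ¬ab) in not-true⇒¬ (inAll i) v)

Exhaustible : (A : Set) → Rel A 0ℓ → Set₁
Exhaustible A _≈_ =
  ∀ (P : A → Set) → (∀ {x y} → x ≈ y → P x → P y) → (∀ x → Dec (P x)) → Dec (∃ P)

bool-exhaustible : Exhaustible Bool _≡_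
bool-exhaustible P _ P? =
  map′ [ (true ,_) , (false ,_) ] (λ { (true , p) → inj₁ p ; (false , p) → inj₂ p })
       (P? true ⊎-dec P? false)

-- Vectors of length m over an exhaustible type are exhaustible, up to
-- pointwise equivalence: search for the head, and for each candidate
-- head recursively for the tail.
vector-exhaustible : ∀ {A : Set} {_≈_ : Rel A 0ℓ} → Reflexive _≈_ →
                     Exhaustible A _≈_ → ∀ m → Exhaustible (Vector A m) (Pointwise _≈_)
vector-exhaustible _ _ zero P resp P? =
  map′ ([] ,_) (λ (xs , p) → resp {xs} (λ ()) p) (P? [])
vector-exhaustible {A} {_≈_} ≈-refl search (suc m) P resp P? =
  map′ (λ (x , xs , p) → x ∷ xs , p) (λ (xs , p) → head xs , tail xs , resp head∷tail p)
       (search Q Q-resp Q?)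
  where
  ∷⁺ : ∀ {x y} {xs ys : Vector A m} → x ≈ y → Pointwise _≈_ xs ys →
       Pointwise _≈_ (x ∷ xs) (y ∷ ys)
  ∷⁺ x≈y _     fzero    = x≈y
  ∷⁺ _   xs≈ys (fsuc i) = xs≈ys i

  head∷tail : ∀ {xs : Vector A (suc m)} → Pointwise _≈_ xs (head xs ∷ tail xs)
  head∷tail fzero    = ≈-refl
  head∷tail (fsuc i) = ≈-refl

  Q : A → Set
  Q x = ∃ λ xs → P (x ∷ xs)

  Q-resp : ∀ {x y} → x ≈ y → Q x → Q y
  Q-resp x≈y (xs , p) = xs , resp (∷⁺ x≈y (λ _ → ≈-refl)) p

  Q? : ∀ x → Dec (Q x)
  Q? x = vector-exhaustible ≈-refl search m (λ xs → P (x ∷ xs))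
           (λ xs≈ys → resp (∷⁺ ≈-refl xs≈ys)) (λ xs → P? (x ∷ xs))

_≐_ : ∀ {n} → Rel (Digraph n) 0ℓ
F ≐ G = ∀ a b → F a b ≡ G a b

-- Digraphs on n vertices are vectors of vectors of Booleans.
digraph-exhaustible : ∀ n → Exhaustible (Digraph n) _≐_
digraph-exhaustible n = vector-exhaustible (λ _ → refl)
                          (vector-exhaustible refl bool-exhaustible n) n

ferrers? : ∀ {n} (F : Digraph n) → Dec (IsFerrers F)
ferrers? F = all? λ v → all? λ w → succ⊆? v w ⊎-dec succ⊆? w v
  where
  succ⊆? : ∀ v w → Dec (∀ u → F v u ≡ true → F w u ≡ true)
  succ⊆? v w = all? λ u → (F v u ≟ true) →-dec (F w u ≟ true)

ferrers-resp : ∀ {n} {F G : Digraph n} → F ≐ G → IsFerrers F → IsFerrers G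
ferrers-resp {F = F} {G} F≐G ferrers v w =
  [ (λ ⊆ → inj₁ (transport v w ⊆)) , (λ ⊇ → inj₂ (transport w v ⊇)) ] (ferrers v w)
  where
  transport : ∀ v w → (∀ u → F v u ≡ true → F w u ≡ true) → ∀ u → G v u ≡ true → G w u ≡ true
  transport v w ⊆ u h =
    subst (_≡ true) (F≐G w u) (⊆ u (subst (_≡ true) (sym (F≐G v u)) h))

module _ {n : ℕ} (D : Digraph n) where

  RepresentsBy : ∀ {k} → (Fin k → Digraph n) → Set
  RepresentsBy F = (∀ i → IsFerrers (F i)) × (∀ a b → (D a b ≡ true) ⇔ (∀ i → F i a b ≡ true))

  representsBy? : ∀ {k} (F : Fin k → Digraph n) → Dec (RepresentsBy F)
  representsBy? F = all? (λ i → ferrers? (F i)) ×-dec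
                    all? λ a → all? λ b → (D a b ≟ true) ⇔-dec all? (λ i → F i a b ≟ true)

  representsBy-resp : ∀ {k} {F G : Fin k → Digraph n} → Pointwise _≐_ F G →
                      RepresentsBy F → RepresentsBy G
  representsBy-resp F≐G (ferrers , D≡⋂F) =
    (λ i → ferrers-resp (F≐G i) (ferrers i)) ,
    λ a b → mk⇔ (λ ab i → subst (_≡ true) (F≐G i a b) (Equivalence.to (D≡⋂F a b) ab i))
                (λ inAll → Equivalence.from (D≡⋂F a b)
                             (λ i → subst (_≡ true) (sym (F≐G i a b)) (inAll i)))

  ferrersRep? : ∀ k → Dec (FerrersRep D k)
  ferrersRep? k = vector-exhaustible (λ _ _ → refl) (digraph-exhaustible n) k
                    RepresentsBy representsBy-resp representsBy?

  -- D is the intersection of its n row digraphs Rᵢ, where Rᵢ agrees with D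
  -- on row i and is complete elsewhere; all rows of Rᵢ but one are full,
  -- so Rᵢ is Ferrers.
  rowRep : FerrersRep D n
  rowRep = R , ferrers , D≡⋂R
    where
    R : Fin n → Digraph n
    R i a b with a ≟ᶠ i
    ... | yes _ = D a b
    ... | no _  = true

    ferrers : ∀ i → IsFerrers (R i)
    ferrers i v w with v ≟ᶠ i | w ≟ᶠ i
    ... | _        | no _     = inj₁ λ _ _ → refl
    ... | no _     | yes _    = inj₂ λ _ _ → refl
    ... | yes refl | yes refl = inj₁ λ _ h → h

    row : ∀ a b i → D a b ≡ true → R i a b ≡ true
    row a b i ab with a ≟ᶠ i
    ... | yes _ = ab
    ... | no _  = refl

    ownRow : ∀ a b → R a a b ≡ true → D a b ≡ true
    ownRow a b h with a ≟ᶠ a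
    ... | yes _ = h
    ... | no a≢a = ⊥-elim (a≢a refl)

    D≡⋂R : ∀ a b → (D a b ≡ true) ⇔ (∀ i → R i a b ≡ true)
    D≡⋂R a b = mk⇔ (λ ab i → row a b i ab) (λ inAll → ownRow a b (inAll a))

search-below : (P : ℕ → Set) → (∀ k → Dec (P k)) →
               ∀ b → (∀ k → k < b → ¬ P k) ⊎ ∃ (IsMinimum P)
search-below P P? zero = inj₁ λ _ ()
search-below P P? (suc b) with search-below P P? b
... | inj₂ least = inj₂ least
... | inj₁ none-below with P? b
...   | yes pb = inj₂ (b , pb , least)
  where
  least : ∀ k → P k → b ≤ k
  least k pk with b ≤? k
  ... | yes b≤k = b≤k
  ... | no b≰k  = ⊥-elim (none-below k (≰⇒> b≰k) pk)
...   | no ¬pb = inj₁ λ k k<1+b pk →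
  [ (λ k<b → none-below k k<b pk) , (λ { refl → ¬pb pk }) ] (m≤n⇒m<n∨m≡n (≤-pred k<1+b))

least-witness : (P : ℕ → Set) → (∀ k → Dec (P k)) → ∀ k → P k → ∃ (IsMinimum P)
least-witness P P? k pk =
  [ (λ none → ⊥-elim (none k ≤-refl pk)) , (λ least → least) ]
    (search-below P P? (suc k))

theorem4 : ∀ (n : ℕ) (D : Digraph n) →
    ∃[ m ] (FerrersDim D m × TotalCoveringNumber (complement D) m)
theorem4 n D =
  let (m , rep , minimal) = least-witness (FerrersRep D) (ferrersRep? D) n (rowRep D)
  in m , (rep , minimal) , (ferrers⇒cover rep , λ k cover → minimal k (cover⇒ferrers cover))
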